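{- Let $\mathcal S$ be a stable set of $n$-cbc and $(P,Q)$ a border of $\mathcal S$. For all $k_1,k_2\in[n]$ and $X,Y\in\mathcal S$, the ordered pairs $$\bigl(P,\,L^n_{k_2}(Ya^Q)\bigr),\quad \bigl(R^n_{k_1}(a^PX),\,L^n_{k_2}(Ya^Q)\bigr),\quad \bigl(R^n_{k_1}(a^PX),\,Q\bigr)$$ are factorizations (of size $n$) bordering $\mathcal S$.
   Context: Fix an alphabet $\mathcal A$ containing distinct letters $a,b$. A code is a set $X\subseteq\mathcal A^*$ such that $x_1\cdots x_t=y_1\cdots y_{t'}$ with $x_i,y_i\in X$ implies $t=t'$ and $x_i=y_i$ for all $i$. Write $[n]=\{0,\dots,n-1\}$, $u\bmod n$ for the remainder in $[n]$, $a^U=\{a^u:u\in U\}$; products of sets of words are sets of concatenations. An $n$-cbc is a set $X\subseteq a^{[n]}ba^{[n]}$ with $|X|=n$ such that $\{a^n\}\cup X$ is a code. For $n$-cbc $X,Y$ and $r\in[n]$, $X\circ_rY=\{a^iba^\ell: a^iba^j\in X, a^kba^\ell\in Y, (j+k)\bmod n=r\}$. A set $\mathcal S$ of $n$-cbc is stable if $X\circ_rY\in\mathcal S$ for all $X,Y\in\mathcal S$, $r\in[n]$. For $X\subseteq\mathcal A^*$, $\underline X=\sum_{x\in X}x$ in $\mathbb Z\langle\langle\mathcal A\rangle\rangle$; $\equiv_n$ is the congruence generated by $a^n=\varepsilon$ (exponents of $a$ read modulo $n$). For finite $P,Q\subseteq\mathbb Z$, $(P,Q)$ borders an $n$-cbc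 $X$ if $\underline{a^P}\,\underline X\,\underline{a^Q}\equiv_n\sum_{i,j\in[n]}a^iba^j$, and borders a set of cbc if it borders each element. A pair $(P,Q)$ of sets of integers is a factorization of size $n$ if every $k\in[n]$ can be written in exactly one way as $k\equiv p+q\pmod n$ with $p\in P,q\in Q$. Write $x\in_nZ$ if $x\equiv_nz$ for some $z\in Z$. For $Z\subseteq a^*ba^*$ and $k\in[n]$: $L^n_k(Z)=\{i\bmod n: a^iba^k\in_nZ\}$ and $R^n_k(Z)=\{j\bmod n: a^kba^j\in_nZ\}$. -}

module Defs where

open import Data.Bool using (Bool; true; false; if_then_else_; _∧_)
open import Data.Nat as ℕ using (ℕ)
open import Data.Integer using (ℤ; +_; _+_; _-_; _≤_; _<_)
open import Data.Integer.Divisibility using (_∣_)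
open import Data.Fin using (Fin; toℕ; _≟_)
open import Data.List using (List; []; _∷_; _++_; replicate; concat; any; map; allFin; cartesianProduct)
open import Data.Nat.ListAction using (sum)
open import Data.List.Relation.Unary.All using (All)
open import Data.List.Membership.Propositional using (_∈_)
open import Data.Product using (Σ; ∃; ∃-syntax; ∃!; _×_; _,_; proj₁; proj₂)
open import Data.Sum using (_⊎_)
open import Function.Bundles using (_⇔_)
open import Relation.Nullary.Decidable using (⌊_⌋)
open import Relation.Binary.PropositionalEquality using (_≡_)

toℤ : ∀ {n} → Fin n → ℤ
toℤ i = + (toℕ i)

_≡_[mod_] : ℤ → ℤ → ℕ → Set
x ≡ y [mod n ] = (+ n) ∣ (x - y)

IntSet : Set₁
IntSet = ℤ → Set

Finite : IntSet → Set
Finite P = ∃[ xs ] (∀ z → (P z ⇔ (z ∈ xs)))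

InRange : ℕ → ℤ → Set
InRange n u = (+ 0 ≤ u) × (u < + n)

IsCode : {A : Set} → (List A → Set) → Set
IsCode {A} C = (xs ys : List (List A)) → All C xs → All C ys →
               concat xs ≡ concat ys → xs ≡ ys

-- A subset of a^[n] b a^[n], given by its characteristic function:
-- X i j = true  iff  a^i b a^j ∈ X
Sub : ℕ → Set
Sub n = Fin n → Fin n → Bool

module _ {A : Set} (a b : A) where

  word : ∀ {n} → Fin n → Fin n → List A
  word i j = replicate (toℕ i) a ++ (b ∷ replicate (toℕ j) a)

  withAn : ∀ {n} → Sub n → List A → Set
  withAn {n} X w = (w ≡ replicate n a) ⊎ (∃[ i ] ∃[ j ] ((X i j ≡ true) × (w ≡ word i j)))

card : ∀ {n} → Sub n → ℕ
card {n} X = sum (map (λ p → if X (proj₁ p) (proj₂ p) then 1 else 0)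
                      (cartesianProduct (allFin n) (allFin n)))

IsCbc : {A : Set} (a b : A) (n : ℕ) → Sub n → Set
IsCbc a b n X = (card X ≡ n) × IsCode (withAn a b X)

InCompose : ∀ {n} → Sub n → Fin n → Sub n → Fin n → Fin n → Set
InCompose {n} X r Y i l =
  ∃[ j ] ∃[ k ] ((X i j ≡ true) × (Y k l ≡ true) × ((toℤ j + toℤ k) ≡ toℤ r [mod n ]))

IsCompose : ∀ {n} → Sub n → Fin n → Sub n → Sub n → Set
IsCompose X r Y Z = ∀ i l → ((Z i l ≡ true) ⇔ InCompose X r Y i l)

SetOfCbc : {A : Set} (a b : A) (n : ℕ) → (Sub n → Set) → Set
SetOfCbc a b n S = ∀ X → S X → IsCbc a b n X

Stable : ∀ {n} → (Sub n → Set) → Set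
Stable {n} S = ∀ X Y → S X → S Y → (r : Fin n) → ∃[ Z ] (S Z × IsCompose X r Y Z)

-- (P,Q) borders X: P, Q finite and  a^P X a^Q ≡_n Σ_{i,j∈[n]} a^i b a^j,
-- i.e. for all u v ∈ [n] there is exactly one (p,(i,j),q) ∈ P × X × Q
-- with p+i ≡ u and j+q ≡ v (mod n).
Borders : ∀ n → IntSet → IntSet → Sub n → Set
Borders n P Q X =
  Finite P × Finite Q ×
  ((u v : Fin n) → ∃! _≡_ (λ (t : ℤ × Fin n × Fin n × ℤ) →
     let (p , i , j , q) = t in
     P p × (X i j ≡ true) × Q q ×
     ((p + toℤ i) ≡ toℤ u [mod n ]) × ((toℤ j + q) ≡ toℤ v [mod n ])))

BordersSet : ∀ n → IntSet → IntSet → (Sub n → Set) → Set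
BordersSet n P Q S = ∀ X → S X → Borders n P Q X

Factorization : ℕ → IntSet → IntSet → Set
Factorization n P Q =
  (k : Fin n) → ∃! _≡_ (λ (t : ℤ × ℤ) →
     P (proj₁ t) × Q (proj₂ t) × (toℤ k ≡ (proj₁ t + proj₂ t) [mod n ]))

-- Subsets of a*ba* (exponents read modulo n, hence integer exponents):
-- a predicate Z on ℤ × ℤ, Z i j meaning a^i b a^j ∈ Z.

WordSet : Set₁
WordSet = ℤ → ℤ → Set

aP· : ∀ {n} → IntSet → Sub n → WordSet
aP· P X i j = ∃[ p ] ∃[ i' ] ∃[ j' ] (P p × (X i' j' ≡ true) × (i ≡ p + toℤ i') × (j ≡ toℤ j'))

·aQ : ∀ {n} → Sub n → IntSet → WordSet
·aQ Y Q i j = ∃[ i' ] ∃[ j' ] ∃[ q ] ((Y i' j' ≡ true) × Q q × (i ≡ toℤ i') × (j ≡ toℤ j' + q))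

In-n : ℕ → WordSet → ℤ → ℤ → Set
In-n n Z i j = ∃[ i' ] ∃[ j' ] (Z i' j' × (i ≡ i' [mod n ]) × (j ≡ j' [mod n ]))

Lset : (n : ℕ) → Fin n → WordSet → IntSet
Lset n k Z u = InRange n u × ∃[ i ] ((u ≡ i [mod n ]) × In-n n Z i (toℤ k))

Rset : (n : ℕ) → Fin n → WordSet → IntSet
Rset n k Z u = InRange n u × ∃[ j ] ((u ≡ j [mod n ]) × In-n n Z (toℤ k) j)

{-# OPTIONS --safe #-}
-- A stable set S of n-cbc is separating: if a^i b a^j, a^i b a^j' ∈ Z and
-- a^k b a^l, a^k' b a^l ∈ Y with j + k ≡ j' + k' (mod n), then j = j' and k = k'.  Indeed
-- T = Y ∘_{l+i} Z ∈ S contains a^c b a^d for c ∈ {k, k'} and d ∈ {j, j'}; if j' + k' = j + k + q n,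
-- the word a^k' b a^(j'+k') b a^j' factors over {a^n} ∪ T both as (a^k' b a^j) (a^n)^q (a^k b a^j')
-- and as (a^k' b a^j') (a^k' b a^j'), so q = 0 and j = j'.
-- The elements of L = L_k(Y a^Q) are the left exponents i of the representations
-- u ≡ p + i, k ≡ j + q bordering Y, so (P, L) tiles [n].  For Z ∈ S, representations of (u, v)
-- by (P, L) on Z correspond to representations of (u, k) by (P, Q) on Z ∘_v Y ∈ S, and separation
-- makes the correspondence functional, so (P, L) borders S.  R_k(a^P X) is the mirror image, and the
-- middle pair comes from applying the right-hand construction to the border (P, L).

module Submission where

open import Defs
open import Data.Bool using (true)
open import Data.Nat as ℕ using (ℕ; zero; suc; z≤n)
open import Data.Nat.Properties as ℕ
  using (≤-total; m+[n∸m]≡n; m≤m+n; m≤n+m; <⇒≱; ≤-trans; +-identityʳ; +-cancelˡ-≡; +-assoc; +-comm)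
open import Data.Nat.Divisibility as ℕ using (divides)
open import Data.Integer using (ℤ; +_; -_; _+_; _-_; _*_; ∣_∣; +≤+; +<+)
open import Data.Integer.Properties using (m-n≡m⊖n; ∣⊖∣-≤)
import Data.Integer.Divisibility.Signed as Signed
open import Data.Integer.DivMod using (_%ℕ_; _/ℕ_; n%ℕd<d; a≡a%ℕn+[a/ℕn]*n)
open import Data.Integer.Tactic.RingSolver using (solve-∀)
open import Data.Fin using (Fin; toℕ; fromℕ<)
open import Data.Fin.Properties using (nonZeroIndex; toℕ<n; toℕ-fromℕ<; toℕ-injective)
open import Data.List using (List; []; _∷_; _++_; replicate; concat; length; map; allFin)
open import Data.List.Membership.Propositional using (_∈_)
open import Data.List.Membership.Propositional.Properties using (∈-map⁺; ∈-map⁻; ∈-allFin)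
open import Data.List.Properties
  using (length-replicate; ++-cancelˡ; ++-assoc; ++-identityʳ; concat-++; ++-conicalʳ; ∷-injective)
open import Data.List.Relation.Unary.All using (All; []; _∷_)
open import Data.List.Relation.Unary.All.Properties using (replicate⁺; ++⁺)
open import Data.Product using (Σ; ∃!; ∃-syntax; _×_; _,_; proj₁; proj₂)
import Data.Product as Product
open import Data.Sum using (inj₁; inj₂)
open import Function.Bundles using (Equivalence; mk⇔)
open import Relation.Nullary using (contradiction)
open import Relation.Binary.PropositionalEquality
  using (_≡_; _≢_; refl; sym; trans; cong; subst; module ≡-Reasoning)

module _ {n : ℕ} where

  private
    signed : ∀ x y → x ≡ y [mod n ] → + n Signed.∣ x - y
    signed _ _ = Signed.∣ᵤ⇒∣

    unsigned : ∀ x y → + n Signed.∣ x - y → x ≡ y [mod n ]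
    unsigned _ _ = Signed.∣⇒∣ᵤ

  ≡[mod]-refl : ∀ {x} → x ≡ x [mod n ]
  ≡[mod]-refl {x} = unsigned x x (Signed.divides (+ 0) (x-x≡0*n x))
    where x-x≡0*n : ∀ x → x - x ≡ + 0 * + n
          x-x≡0*n = solve-∀

  ≡[mod]-sym : ∀ {x y} → x ≡ y [mod n ] → y ≡ x [mod n ]
  ≡[mod]-sym {x} {y} x≡y =
    unsigned y x (subst (+ n Signed.∣_) (-[x-y]≡y-x x y) (Signed.∣m⇒∣-m (signed x y x≡y)))
    where -[x-y]≡y-x : ∀ x y → - (x - y) ≡ y - x
          -[x-y]≡y-x = solve-∀

  ≡[mod]-trans : ∀ {x y z} → x ≡ y [mod n ] → y ≡ z [mod n ] → x ≡ z [mod n ]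
  ≡[mod]-trans {x} {y} {z} x≡y y≡z =
    unsigned x z (subst (+ n Signed.∣_) ([x-y]+[y-z]≡x-z x y z)
                        (Signed.∣m∣n⇒∣m+n (signed x y x≡y) (signed y z y≡z)))
    where [x-y]+[y-z]≡x-z : ∀ x y z → (x - y) + (y - z) ≡ x - z
          [x-y]+[y-z]≡x-z = solve-∀

  ≡[mod]⇒≡+* : ∀ {x y} → x ℕ.≤ y → (+ x) ≡ (+ y) [mod n ] → ∃[ q ] y ≡ x ℕ.+ q ℕ.* n
  ≡[mod]⇒≡+* {x} {y} x≤y x≡y
    with subst (n ℕ.∣_) (trans (cong ∣_∣ (m-n≡m⊖n x y)) (∣⊖∣-≤ x≤y)) x≡y
  ... | divides q y∸x≡q*n = q , trans (sym (m+[n∸m]≡n x≤y)) (cong (x ℕ.+_) y∸x≡q*n)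

  private
    ≤-≡[mod]⇒≡ : ∀ {x y} → y ℕ.< n → x ℕ.≤ y → (+ x) ≡ (+ y) [mod n ] → x ≡ y
    ≤-≡[mod]⇒≡ {x} {y} y<n x≤y x≡y with ≡[mod]⇒≡+* x≤y x≡y
    ... | zero  , y≡x+0 = sym (trans y≡x+0 (+-identityʳ x))
    ... | suc q , y≡x+n+q*n =
      contradiction (subst (n ℕ.≤_) (sym y≡x+n+q*n) (≤-trans (m≤m+n n _) (m≤n+m _ x))) (<⇒≱ y<n)

  ≡[mod]⇒≡ : ∀ {x y} → x ℕ.< n → y ℕ.< n → (+ x) ≡ (+ y) [mod n ] → x ≡ y
  ≡[mod]⇒≡ {x} {y} x<n y<n x≡y with ≤-total x y
  ... | inj₁ x≤y = ≤-≡[mod]⇒≡ y<n x≤y x≡y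
  ... | inj₂ y≤x = sym (≤-≡[mod]⇒≡ x<n y≤x (≡[mod]-sym {x = + x} {y = + y} x≡y))

  InRange-toℤ : (i : Fin n) → InRange n (toℤ i)
  InRange-toℤ i = +≤+ z≤n , +<+ (toℕ<n i)

  InRange-≡[mod]⇒≡ : ∀ {u} (j : Fin n) → InRange n u → u ≡ toℤ j [mod n ] → u ≡ toℤ j
  InRange-≡[mod]⇒≡ {+ m} j (_ , +<+ m<n) u≡j = cong +_ (≡[mod]⇒≡ m<n (toℕ<n j) u≡j)

  residue : .{{_ : ℕ.NonZero n}} (z : ℤ) → Σ (Fin n) λ u → z ≡ toℤ u [mod n ]
  residue z = fromℕ< r<n , unsigned z _ (Signed.divides (z /ℕ n) (begin
      z - + toℕ (fromℕ< r<n)                  ≡⟨ cong (λ r → z - + r) (toℕ-fromℕ< r<n) ⟩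
      z - + (z %ℕ n)                          ≡⟨ cong (_- + (z %ℕ n)) (a≡a%ℕn+[a/ℕn]*n z n) ⟩
      (+ (z %ℕ n) + (z /ℕ n) * + n) - + (z %ℕ n) ≡⟨ [r+t]-r≡t (+ (z %ℕ n)) _ ⟩
      (z /ℕ n) * + n                          ∎))
    where
    open ≡-Reasoning
    r<n : z %ℕ n ℕ.< n
    r<n = n%ℕd<d z n
    [r+t]-r≡t : ∀ r t → (r + t) - r ≡ t
    [r+t]-r≡t = solve-∀

module _ {A : Set} {x : A} where

  replicate-++-replicate : ∀ m n {xs} →
    replicate m x ++ (replicate n x ++ xs) ≡ replicate (m ℕ.+ n) x ++ xs
  replicate-++-replicate zero    n = refl
  replicate-++-replicate (suc m) n = cong (x ∷_) (replicate-++-replicate m n)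

  concat-replicate-replicate-++ : ∀ q n {xs} →
    concat (replicate q (replicate n x)) ++ xs ≡ replicate (q ℕ.* n) x ++ xs
  concat-replicate-replicate-++ zero    n = refl
  concat-replicate-replicate-++ (suc q) n {xs} = begin
    (replicate n x ++ concat (replicate q (replicate n x))) ++ xs
      ≡⟨ ++-assoc (replicate n x) _ xs ⟩
    replicate n x ++ (concat (replicate q (replicate n x)) ++ xs)
      ≡⟨ cong (replicate n x ++_) (concat-replicate-replicate-++ q n) ⟩
    replicate n x ++ (replicate (q ℕ.* n) x ++ xs)
      ≡⟨ replicate-++-replicate n (q ℕ.* n) ⟩
    replicate (n ℕ.+ q ℕ.* n) x ++ xs ∎
    where open ≡-Reasoning

  replicate-injective : ∀ {m n} → replicate m x ≡ replicate n x → m ≡ n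
  replicate-injective {m} {n} eq =
    trans (sym (length-replicate m)) (trans (cong length eq) (length-replicate n))

module _ {A : Set} (a b : A) where

  aⁱbaʲ : ℕ → ℕ → List A
  aⁱbaʲ i j = replicate i a ++ b ∷ replicate j a

  aⁱbaʲ-injectiveʳ : ∀ i {j j'} → aⁱbaʲ i j ≡ aⁱbaʲ i j' → j ≡ j'
  aⁱbaʲ-injectiveʳ i eq = replicate-injective (proj₂ (∷-injective (++-cancelˡ (replicate i a) _ _ eq)))

  concat-aⁱbaʲ-aⁿ-aⁱbaʲ : ∀ {n} i j q k l →
    concat (aⁱbaʲ i j ∷ replicate q (replicate n a) ++ aⁱbaʲ k l ∷ []) ≡
    replicate i a ++ b ∷ replicate (j ℕ.+ q ℕ.* n ℕ.+ k) a ++ b ∷ replicate l a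
  concat-aⁱbaʲ-aⁿ-aⁱbaʲ {n} i j q k l = begin
    aⁱbaʲ i j ++ concat (replicate q (replicate n a) ++ aⁱbaʲ k l ∷ [])
      ≡⟨ cong (aⁱbaʲ i j ++_) (sym (concat-++ (replicate q (replicate n a)) _)) ⟩
    aⁱbaʲ i j ++ (concat (replicate q (replicate n a)) ++ aⁱbaʲ k l ++ [])
      ≡⟨ cong (λ w → aⁱbaʲ i j ++ (concat (replicate q (replicate n a)) ++ w)) (++-identityʳ _) ⟩
    aⁱbaʲ i j ++ (concat (replicate q (replicate n a)) ++ aⁱbaʲ k l)
      ≡⟨ cong (aⁱbaʲ i j ++_) (concat-replicate-replicate-++ q n) ⟩
    aⁱbaʲ i j ++ (replicate (q ℕ.* n) a ++ aⁱbaʲ k l)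
      ≡⟨ ++-assoc (replicate i a) _ _ ⟩
    replicate i a ++ b ∷ (replicate j a ++ (replicate (q ℕ.* n) a ++ (replicate k a ++ _)))
      ≡⟨ cong (λ u → replicate i a ++ b ∷ (replicate j a ++ u)) (replicate-++-replicate (q ℕ.* n) k) ⟩
    replicate i a ++ b ∷ (replicate j a ++ (replicate (q ℕ.* n ℕ.+ k) a ++ _))
      ≡⟨ cong (λ u → replicate i a ++ b ∷ u) (replicate-++-replicate j _) ⟩
    replicate i a ++ b ∷ replicate (j ℕ.+ (q ℕ.* n ℕ.+ k)) a ++ b ∷ replicate l a
      ≡⟨ cong (λ e → replicate i a ++ b ∷ replicate e a ++ b ∷ replicate l a) (sym (+-assoc j _ k)) ⟩
    replicate i a ++ b ∷ replicate (j ℕ.+ q ℕ.* n ℕ.+ k) a ++ b ∷ replicate l a ∎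
    where open ≡-Reasoning

  code-separates-≤ : ∀ {n} {T : Sub n} → IsCode (withAn a b T) → ∀ {j j' k k'} →
    T k' j ≡ true → T k j' ≡ true → T k' j' ≡ true →
    toℕ j ℕ.+ toℕ k ℕ.≤ toℕ j' ℕ.+ toℕ k' → (toℤ j + toℤ k) ≡ (toℤ j' + toℤ k') [mod n ] →
    j ≡ j' × k ≡ k'
  code-separates-≤ {n} {T} code {j} {j'} {k} {k'} Tk'j Tkj' Tk'j' x≤y x≡y
    with ≡[mod]⇒≡+* x≤y x≡y
  ... | q , y≡x+q*n = factorisations-agree q y≡x+q*n
          (code (lhs q) rhs (lhs-words q) (word∈ Tk'j' ∷ word∈ Tk'j' ∷ []) (same-concat q y≡x+q*n))
    where
    lhs : ℕ → List (List A)
    lhs q = word a b k' j ∷ replicate q (replicate n a) ++ word a b k j' ∷ []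

    rhs : List (List A)
    rhs = word a b k' j' ∷ word a b k' j' ∷ []

    word∈ : ∀ {c d} → T c d ≡ true → withAn a b T (word a b c d)
    word∈ {c} {d} Tcd = inj₂ (c , d , Tcd , refl)

    exponents : ∀ q → toℕ j' ℕ.+ toℕ k' ≡ toℕ j ℕ.+ toℕ k ℕ.+ q ℕ.* n →
                toℕ j ℕ.+ q ℕ.* n ℕ.+ toℕ k ≡ toℕ j' ℕ.+ 0 ℕ.+ toℕ k'
    exponents q y≡x+q*n = begin
      toℕ j ℕ.+ q ℕ.* n ℕ.+ toℕ k   ≡⟨ swap (toℕ j) (q ℕ.* n) (toℕ k) ⟩
      toℕ j ℕ.+ toℕ k ℕ.+ q ℕ.* n   ≡⟨ sym y≡x+q*n ⟩
      toℕ j' ℕ.+ toℕ k'             ≡⟨ cong (ℕ._+ toℕ k') (sym (+-identityʳ (toℕ j'))) ⟩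
      toℕ j' ℕ.+ 0 ℕ.+ toℕ k'       ∎
      where
      open ≡-Reasoning
      swap : ∀ x y z → x ℕ.+ y ℕ.+ z ≡ x ℕ.+ z ℕ.+ y
      swap x y z = trans (+-assoc x y z) (trans (cong (x ℕ.+_) (+-comm y z)) (sym (+-assoc x z y)))

    lhs-words : ∀ q → All (withAn a b T) (lhs q)
    lhs-words q = word∈ Tk'j ∷ ++⁺ (replicate⁺ q (inj₁ refl)) (word∈ Tkj' ∷ [])

    same-concat : ∀ q → toℕ j' ℕ.+ toℕ k' ≡ toℕ j ℕ.+ toℕ k ℕ.+ q ℕ.* n →
      concat (lhs q) ≡ concat rhs
    same-concat q y≡x+q*n = begin
      concat (lhs q)
        ≡⟨ concat-aⁱbaʲ-aⁿ-aⁱbaʲ (toℕ k') (toℕ j) q (toℕ k) (toℕ j') ⟩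
      replicate (toℕ k') a ++ b ∷ replicate (toℕ j ℕ.+ q ℕ.* n ℕ.+ toℕ k) a ++ b ∷ replicate (toℕ j') a
        ≡⟨ cong (λ e → replicate (toℕ k') a ++ b ∷ replicate e a ++ b ∷ replicate (toℕ j') a)
                (exponents q y≡x+q*n) ⟩
      replicate (toℕ k') a ++ b ∷ replicate (toℕ j' ℕ.+ 0 ℕ.+ toℕ k') a ++ b ∷ replicate (toℕ j') a
        ≡⟨ concat-aⁱbaʲ-aⁿ-aⁱbaʲ {n} (toℕ k') (toℕ j') 0 (toℕ k') (toℕ j') ⟨
      concat rhs ∎
      where open ≡-Reasoning

    factorisations-agree : ∀ q → toℕ j' ℕ.+ toℕ k' ≡ toℕ j ℕ.+ toℕ k ℕ.+ q ℕ.* n →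
      lhs q ≡ rhs → j ≡ j' × k ≡ k'
    factorisations-agree zero y≡x eq = j≡j' , toℕ-injective (+-cancelˡ-≡ (toℕ j) _ _ (begin
      toℕ j ℕ.+ toℕ k        ≡⟨ sym (+-identityʳ _) ⟩
      toℕ j ℕ.+ toℕ k ℕ.+ 0  ≡⟨ sym y≡x ⟩
      toℕ j' ℕ.+ toℕ k'      ≡⟨ cong (λ i → toℕ i ℕ.+ toℕ k') (sym j≡j') ⟩
      toℕ j ℕ.+ toℕ k'       ∎))
      where
      open ≡-Reasoning
      j≡j' : j ≡ j'
      j≡j' = toℕ-injective (aⁱbaʲ-injectiveʳ (toℕ k') (proj₁ (∷-injective eq)))
    factorisations-agree (suc q) _ eq
      with ++-conicalʳ (replicate q (replicate n a)) _ (proj₂ (∷-injective (proj₂ (∷-injective eq))))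
    ... | ()

  code-separates : ∀ {n} {T : Sub n} → IsCode (withAn a b T) → ∀ {j j' k k'} →
    T k j ≡ true → T k' j ≡ true → T k j' ≡ true → T k' j' ≡ true →
    (toℤ j + toℤ k) ≡ (toℤ j' + toℤ k') [mod n ] → j ≡ j' × k ≡ k'
  code-separates code {j} {j'} {k} {k'} Tkj Tk'j Tkj' Tk'j' j+k≡j'+k'
    with ≤-total (toℕ j ℕ.+ toℕ k) (toℕ j' ℕ.+ toℕ k')
  ... | inj₁ x≤y = code-separates-≤ code Tk'j Tkj' Tk'j' x≤y j+k≡j'+k'
  ... | inj₂ y≤x = Product.map sym sym
    (code-separates-≤ code Tkj' Tk'j Tkj y≤x
      (≡[mod]-sym {x = toℤ j + toℤ k} {y = toℤ j' + toℤ k'} j+k≡j'+k'))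

Separating : ∀ {n} → (Sub n → Set) → Set
Separating {n} S = ∀ {Z Y} → S Z → S Y → ∀ {i j j' k k' l r} →
  Z i j ≡ true → Z i j' ≡ true → Y k l ≡ true → Y k' l ≡ true →
  (toℤ j + toℤ k) ≡ r [mod n ] → (toℤ j' + toℤ k') ≡ r [mod n ] → j ≡ j' × k ≡ k'

stable⇒separating : {A : Set} (a b : A) {n : ℕ} {S : Sub n → Set} →
  SetOfCbc a b n S → Stable S → Separating S
stable⇒separating a b cbc stable {Z} {Y} SZ SY {i} {j} {j'} {k} {k'} {l} {r}
                  Zij Zij' Ykl Yk'l j+k≡r j'+k'≡r
  with residue ⦃ nonZeroIndex i ⦄ (toℤ l + toℤ i)
... | s , l+i≡s with stable Y Z SY SZ s
... | T , ST , T≡Y∘Z =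
  code-separates a b (proj₂ (cbc T ST)) (in-T Ykl Zij) (in-T Yk'l Zij) (in-T Ykl Zij') (in-T Yk'l Zij')
    (≡[mod]-trans {x = toℤ j + toℤ k} {y = r} {z = toℤ j' + toℤ k'} j+k≡r
                  (≡[mod]-sym {x = toℤ j' + toℤ k'} {y = r} j'+k'≡r))
  where
  in-T : ∀ {c d} → Y c l ≡ true → Z i d ≡ true → T c d ≡ true
  in-T Ycl Zid = Equivalence.from (T≡Y∘Z _ _) (l , i , Ycl , Zid , l+i≡s)

∃!-transfer : {A B : Set} {P : A → Set} {Q : B → Set} (R : A → B → Set) → ∃! _≡_ P →
  (∀ x → P x → ∃[ y ] Q y × R x y) → (∀ y → Q y → ∃[ x ] P x × R x y) →
  (∀ x y y' → R x y → R x y' → y ≡ y') → ∃! _≡_ Q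
∃!-transfer R (x , Px , unique) forth back functional with forth x Px
... | y , Qy , Rxy = y , Qy , λ {y'} Qy' →
  let x' , Px' , Rx'y' = back y' Qy' in functional x y y' Rxy (subst (λ z → R z y') (sym (unique Px')) Rx'y')

Finite-image : ∀ {n} {C : IntSet} (f : Fin n → ℤ) →
  (∀ m → C (f m)) → (∀ {z} → C z → ∃[ m ] z ≡ f m) → Finite C
Finite-image {n} {C} f C-f cover =
  map f (allFin n) , λ z → mk⇔ (covered z) (λ z∈ → image (∈-map⁻ f z∈))
  where
  covered : ∀ z → C z → z ∈ map f (allFin n)
  covered z Cz with cover Cz
  ... | m , refl = ∈-map⁺ f (∈-allFin m)
  image : ∀ {z} → ∃[ m ] m ∈ allFin n × z ≡ f m → C z
  image (m , _ , refl) = C-f m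

BorderWitness : ∀ n → IntSet → IntSet → Sub n → Fin n → Fin n → ℤ × Fin n × Fin n × ℤ → Set
BorderWitness n P Q X u v t = let (p , i , j , q) = t in
  P p × (X i j ≡ true) × Q q × ((p + toℤ i) ≡ toℤ u [mod n ]) × ((toℤ j + q) ≡ toℤ v [mod n ])

FactorizationWitness : ∀ n → IntSet → IntSet → Fin n → ℤ × ℤ → Set
FactorizationWitness n P Q k t = P (proj₁ t) × Q (proj₂ t) × (toℤ k ≡ (proj₁ t + proj₂ t) [mod n ])

unique-witness : ∀ {n P Q X} → Borders n P Q X →
  (u v : Fin n) → ∃! _≡_ (BorderWitness n P Q X u v)
unique-witness (_ , _ , unique) = unique

module _ {n : ℕ} {Q : IntSet} {Y : Sub n} (k : Fin n) where

  Lset-·aQ⁺ : ∀ {y₁ y₂ q} → Y y₁ y₂ ≡ true → Q q → (toℤ y₂ + q) ≡ toℤ k [mod n ] →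
    Lset n k (·aQ Y Q) (toℤ y₁)
  Lset-·aQ⁺ {y₁} {y₂} {q} Yy Qq y₂+q≡k =
    InRange-toℤ y₁ , toℤ y₁ , ≡[mod]-refl {x = toℤ y₁} , toℤ y₁ , toℤ y₂ + q ,
    (y₁ , y₂ , q , Yy , Qq , refl , refl) , ≡[mod]-refl {x = toℤ y₁} ,
    ≡[mod]-sym {x = toℤ y₂ + q} {y = toℤ k} y₂+q≡k

  Lset-·aQ⁻ : ∀ {ℓ} → Lset n k (·aQ Y Q) ℓ →
    ∃[ y₁ ] ∃[ y₂ ] ∃[ q ] Y y₁ y₂ ≡ true × Q q × ℓ ≡ toℤ y₁ × ((toℤ y₂ + q) ≡ toℤ k [mod n ])
  Lset-·aQ⁻ {ℓ} (ℓ∈[n] , i , ℓ≡i , ._ , ._ , (y₁ , y₂ , q , Yy , Qq , refl , refl) , i≡y₁ , k≡y₂+q) =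
    y₁ , y₂ , q , Yy , Qq ,
    InRange-≡[mod]⇒≡ y₁ ℓ∈[n] (≡[mod]-trans {x = ℓ} {y = i} {z = toℤ y₁} ℓ≡i i≡y₁) ,
    ≡[mod]-sym {x = toℤ k} {y = toℤ y₂ + q} k≡y₂+q

  module _ {P : IntSet} (bY : Borders n P Q Y) where

    Lset-factorization : Factorization n P (Lset n k (·aQ Y Q))
    Lset-factorization k′ =
      ∃!-transfer (λ t t′ → image t ≡ t′) (unique-witness bY k′ k) forth back
                  (λ { _ _ _ refl refl → refl })
      where
      image : ℤ × Fin n × Fin n × ℤ → ℤ × ℤ
      image (p , y₁ , _) = p , toℤ y₁
      forth : ∀ t → BorderWitness n P Q Y k′ k t →
        ∃[ t′ ] FactorizationWitness n P (Lset n k (·aQ Y Q)) k′ t′ × image t ≡ t′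
      forth (p , y₁ , _) (Pp , Yy , Qq , p+y₁≡k′ , y₂+q≡k) =
        _ , (Pp , Lset-·aQ⁺ Yy Qq y₂+q≡k , ≡[mod]-sym {x = p + toℤ y₁} {y = toℤ k′} p+y₁≡k′) , refl
      back : ∀ t′ → FactorizationWitness n P (Lset n k (·aQ Y Q)) k′ t′ →
        ∃[ t ] BorderWitness n P Q Y k′ k t × image t ≡ t′
      back (p , ℓ) (Pp , Lℓ , k′≡p+ℓ) with Lset-·aQ⁻ Lℓ
      ... | y₁ , y₂ , q , Yy , Qq , refl , y₂+q≡k =
        (p , y₁ , y₂ , q) ,
        (Pp , Yy , Qq , ≡[mod]-sym {x = toℤ k′} {y = p + toℤ y₁} k′≡p+ℓ , y₂+q≡k) , refl

    Lset-finite : Finite (Lset n k (·aQ Y Q))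
    Lset-finite = Finite-image left-exponent in-Lset cover
      where
      left-exponent : Fin n → ℤ
      left-exponent m = toℤ (proj₁ (proj₂ (proj₁ (unique-witness bY m k))))
      in-Lset : ∀ m → Lset n k (·aQ Y Q) (left-exponent m)
      in-Lset m with unique-witness bY m k
      ... | _ , (_ , Yy , Qq , _ , y₂+q≡k) , _ = Lset-·aQ⁺ Yy Qq y₂+q≡k
      cover : ∀ {ℓ} → Lset n k (·aQ Y Q) ℓ → ∃[ m ] ℓ ≡ left-exponent m
      cover Lℓ with Lset-·aQ⁻ Lℓ | unique-witness bY k k
      ... | y₁ , y₂ , q , Yy , Qq , refl , y₂+q≡k | (p , _) , (Pp , _) , _
        with residue ⦃ nonZeroIndex k ⦄ (p + toℤ y₁)
      ... | m , p+y₁≡m =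
        m , cong (λ t → toℤ (proj₁ (proj₂ t)))
                 (sym (proj₂ (proj₂ (unique-witness bY m k)) (Pp , Yy , Qq , p+y₁≡m , y₂+q≡k)))

module _ {n : ℕ} {S : Sub n → Set} (stable : Stable S) (separating : Separating S)
         {P Q : IntSet} (border : BordersSet n P Q S) (k : Fin n) {Y : Sub n} (SY : S Y) where

  Lset-borders : BordersSet n P (Lset n k (·aQ Y Q)) S
  Lset-borders Z SZ = proj₁ (border Z SZ) , Lset-finite k (border Y SY) , tiling
    where
    L : IntSet
    L = Lset n k (·aQ Y Q)

    tiling : ∀ u v → ∃! _≡_ (BorderWitness n P L Z u v)
    tiling u v with stable Z Y SZ SY v
    ... | W , SW , W≡Z∘Y =
      ∃!-transfer Decomposes (unique-witness (border W SW) u k) forth back functional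
      where
      Decomposes : ℤ × Fin n × Fin n × ℤ → ℤ × Fin n × Fin n × ℤ → Set
      Decomposes (p , w₁ , w₂ , q) (p′ , i , j , ℓ) = p ≡ p′ × w₁ ≡ i ×
        ∃[ y₁ ] Z w₁ j ≡ true × Y y₁ w₂ ≡ true × ℓ ≡ toℤ y₁ × ((toℤ j + toℤ y₁) ≡ toℤ v [mod n ])

      forth : ∀ t → BorderWitness n P Q W u k t →
        ∃[ t′ ] BorderWitness n P L Z u v t′ × Decomposes t t′
      forth (p , w₁ , w₂ , q) (Pp , Ww , Qq , p+w₁≡u , w₂+q≡k) with Equivalence.to (W≡Z∘Y w₁ w₂) Ww
      ... | j , y₁ , Zj , Yy₁ , j+y₁≡v =
        (p , w₁ , j , toℤ y₁) , (Pp , Zj , Lset-·aQ⁺ k Yy₁ Qq w₂+q≡k , p+w₁≡u , j+y₁≡v) ,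
        refl , refl , y₁ , Zj , Yy₁ , refl , j+y₁≡v

      back : ∀ t′ → BorderWitness n P L Z u v t′ →
        ∃[ t ] BorderWitness n P Q W u k t × Decomposes t t′
      back (p , i , j , ℓ) (Pp , Zij , Lℓ , p+i≡u , j+ℓ≡v) with Lset-·aQ⁻ k Lℓ
      ... | y₁ , y₂ , q , Yy , Qq , refl , y₂+q≡k =
        (p , i , y₂ , q) ,
        (Pp , Equivalence.from (W≡Z∘Y i y₂) (j , y₁ , Zij , Yy , j+ℓ≡v) , Qq , p+i≡u , y₂+q≡k) ,
        refl , refl , y₁ , Zij , Yy , refl , j+ℓ≡v

      functional : ∀ t t′ t″ → Decomposes t t′ → Decomposes t t″ → t′ ≡ t″
      functional _ _ _ (refl , refl , y₁ , Zj , Yy₁ , refl , j+y₁≡v)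
                       (refl , refl , y₁′ , Zj′ , Yy₁′ , refl , j′+y₁′≡v)
        with separating SZ SY {r = toℤ v} Zj Zj′ Yy₁ Yy₁′ j+y₁≡v j′+y₁′≡v
      ... | refl , refl = refl

module _ {n : ℕ} {P : IntSet} {X : Sub n} (k : Fin n) where

  Rset-aP·⁺ : ∀ {p x₁ x₂} → P p → X x₁ x₂ ≡ true → (p + toℤ x₁) ≡ toℤ k [mod n ] →
    Rset n k (aP· P X) (toℤ x₂)
  Rset-aP·⁺ {p} {x₁} {x₂} Pp Xx p+x₁≡k =
    InRange-toℤ x₂ , toℤ x₂ , ≡[mod]-refl {x = toℤ x₂} , p + toℤ x₁ , toℤ x₂ ,
    (p , x₁ , x₂ , Pp , Xx , refl , refl) , ≡[mod]-sym {x = p + toℤ x₁} {y = toℤ k} p+x₁≡k ,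
    ≡[mod]-refl {x = toℤ x₂}

  Rset-aP·⁻ : ∀ {ρ} → Rset n k (aP· P X) ρ →
    ∃[ p ] ∃[ x₁ ] ∃[ x₂ ] P p × X x₁ x₂ ≡ true × ρ ≡ toℤ x₂ × ((p + toℤ x₁) ≡ toℤ k [mod n ])
  Rset-aP·⁻ {ρ} (ρ∈[n] , j , ρ≡j , ._ , ._ , (p , x₁ , x₂ , Pp , Xx , refl , refl) , k≡p+x₁ , j≡x₂) =
    p , x₁ , x₂ , Pp , Xx ,
    InRange-≡[mod]⇒≡ x₂ ρ∈[n] (≡[mod]-trans {x = ρ} {y = j} {z = toℤ x₂} ρ≡j j≡x₂) ,
    ≡[mod]-sym {x = toℤ k} {y = p + toℤ x₁} k≡p+x₁

  module _ {Q : IntSet} (bX : Borders n P Q X) where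

    Rset-factorization : Factorization n (Rset n k (aP· P X)) Q
    Rset-factorization k′ =
      ∃!-transfer (λ t t′ → image t ≡ t′) (unique-witness bX k k′) forth back
                  (λ { _ _ _ refl refl → refl })
      where
      image : ℤ × Fin n × Fin n × ℤ → ℤ × ℤ
      image (_ , _ , x₂ , q) = toℤ x₂ , q
      forth : ∀ t → BorderWitness n P Q X k k′ t →
        ∃[ t′ ] FactorizationWitness n (Rset n k (aP· P X)) Q k′ t′ × image t ≡ t′
      forth (_ , _ , x₂ , q) (Pp , Xx , Qq , p+x₁≡k , x₂+q≡k′) =
        _ , (Rset-aP·⁺ Pp Xx p+x₁≡k , Qq , ≡[mod]-sym {x = toℤ x₂ + q} {y = toℤ k′} x₂+q≡k′) , refl
      back : ∀ t′ → FactorizationWitness n (Rset n k (aP· P X)) Q k′ t′ →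
        ∃[ t ] BorderWitness n P Q X k k′ t × image t ≡ t′
      back (ρ , q) (Rρ , Qq , k′≡ρ+q) with Rset-aP·⁻ Rρ
      ... | p , x₁ , x₂ , Pp , Xx , refl , p+x₁≡k =
        (p , x₁ , x₂ , q) ,
        (Pp , Xx , Qq , p+x₁≡k , ≡[mod]-sym {x = toℤ k′} {y = toℤ x₂ + q} k′≡ρ+q) , refl

    Rset-finite : Finite (Rset n k (aP· P X))
    Rset-finite = Finite-image right-exponent in-Rset cover
      where
      right-exponent : Fin n → ℤ
      right-exponent m = toℤ (proj₁ (proj₂ (proj₂ (proj₁ (unique-witness bX k m)))))
      in-Rset : ∀ m → Rset n k (aP· P X) (right-exponent m)
      in-Rset m with unique-witness bX k m
      ... | _ , (Pp , Xx , _ , p+x₁≡k , _) , _ = Rset-aP·⁺ Pp Xx p+x₁≡k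
      cover : ∀ {ρ} → Rset n k (aP· P X) ρ → ∃[ m ] ρ ≡ right-exponent m
      cover Rρ with Rset-aP·⁻ Rρ | unique-witness bX k k
      ... | p , x₁ , x₂ , Pp , Xx , refl , p+x₁≡k | (_ , _ , _ , q) , (_ , _ , Qq , _) , _
        with residue ⦃ nonZeroIndex k ⦄ (toℤ x₂ + q)
      ... | m , x₂+q≡m =
        m , cong (λ t → toℤ (proj₁ (proj₂ (proj₂ t))))
                 (sym (proj₂ (proj₂ (unique-witness bX k m)) (Pp , Xx , Qq , p+x₁≡k , x₂+q≡m)))

module _ {n : ℕ} {S : Sub n → Set} (stable : Stable S) (separating : Separating S)
         {P Q : IntSet} (border : BordersSet n P Q S) (k : Fin n) {X : Sub n} (SX : S X) where

  Rset-borders : BordersSet n (Rset n k (aP· P X)) Q S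
  Rset-borders Z SZ = Rset-finite k (border X SX) , proj₁ (proj₂ (border Z SZ)) , tiling
    where
    R : IntSet
    R = Rset n k (aP· P X)

    tiling : ∀ u v → ∃! _≡_ (BorderWitness n R Q Z u v)
    tiling u v with stable X Z SX SZ u
    ... | W , SW , W≡X∘Z =
      ∃!-transfer Decomposes (unique-witness (border W SW) k v) forth back functional
      where
      Decomposes : ℤ × Fin n × Fin n × ℤ → ℤ × Fin n × Fin n × ℤ → Set
      Decomposes (p , w₁ , w₂ , q) (ρ , i , j , q′) = w₂ ≡ j × q ≡ q′ ×
        ∃[ x₂ ] X w₁ x₂ ≡ true × Z i w₂ ≡ true × ρ ≡ toℤ x₂ × ((toℤ x₂ + toℤ i) ≡ toℤ u [mod n ])

      forth : ∀ t → BorderWitness n P Q W k v t →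
        ∃[ t′ ] BorderWitness n R Q Z u v t′ × Decomposes t t′
      forth (p , w₁ , w₂ , q) (Pp , Ww , Qq , p+w₁≡k , w₂+q≡v) with Equivalence.to (W≡X∘Z w₁ w₂) Ww
      ... | x₂ , i , Xx₂ , Zi , x₂+i≡u =
        (toℤ x₂ , i , w₂ , q) , (Rset-aP·⁺ k Pp Xx₂ p+w₁≡k , Zi , Qq , x₂+i≡u , w₂+q≡v) ,
        refl , refl , x₂ , Xx₂ , Zi , refl , x₂+i≡u

      back : ∀ t′ → BorderWitness n R Q Z u v t′ →
        ∃[ t ] BorderWitness n P Q W k v t × Decomposes t t′
      back (ρ , i , j , q) (Rρ , Zij , Qq , ρ+i≡u , j+q≡v) with Rset-aP·⁻ k Rρ
      ... | p , x₁ , x₂ , Pp , Xx , refl , p+x₁≡k =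
        (p , x₁ , j , q) ,
        (Pp , Equivalence.from (W≡X∘Z x₁ j) (x₂ , i , Xx , Zij , ρ+i≡u) , Qq , p+x₁≡k , j+q≡v) ,
        refl , refl , x₂ , Xx , Zij , refl , ρ+i≡u

      functional : ∀ t t′ t″ → Decomposes t t′ → Decomposes t t″ → t′ ≡ t″
      functional _ _ _ (refl , refl , x₂ , Xx₂ , Zi , refl , x₂+i≡u)
                       (refl , refl , x₂′ , Xx₂′ , Zi′ , refl , x₂′+i′≡u)
        with separating SX SZ {r = toℤ u} Xx₂ Xx₂′ Zi Zi′ x₂+i≡u x₂′+i′≡u
      ... | refl , refl = refl

mainTheorem7 : {A : Set} (a b : A) → a ≢ b →
    (n : ℕ) (S : Sub n → Set) → SetOfCbc a b n S → Stable S →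
    (P Q : IntSet) → BordersSet n P Q S →
    (k₁ k₂ : Fin n) (X Y : Sub n) → S X → S Y →
    (Factorization n P (Lset n k₂ (·aQ Y Q)) × BordersSet n P (Lset n k₂ (·aQ Y Q)) S)
    × (Factorization n (Rset n k₁ (aP· P X)) (Lset n k₂ (·aQ Y Q))
       × BordersSet n (Rset n k₁ (aP· P X)) (Lset n k₂ (·aQ Y Q)) S)
    × (Factorization n (Rset n k₁ (aP· P X)) Q × BordersSet n (Rset n k₁ (aP· P X)) Q S)
-- a ≢ b is unused: separation only needs {aⁿ} ∪ T to be a code.
mainTheorem7 a b _ n S cbc stable P Q border k₁ k₂ X Y SX SY =
    (Lset-factorization k₂ (border Y SY) , PL-borders)
  , (Rset-factorization k₁ (PL-borders X SX) , Rset-borders stable separating PL-borders k₁ SX)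
  , (Rset-factorization k₁ (border X SX) , Rset-borders stable separating border k₁ SX)
  where
  separating : Separating S
  separating = stable⇒separating a b cbc stable
  PL-borders : BordersSet n P (Lset n k₂ (·aQ Y Q)) S
  PL-borders = Lset-borders stable separating border k₂ SY
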